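{- Let $G$ be a graph with vertices $v_1,\dots,v_n$ and edges $e_1,\dots,e_m$. Let $p$ be a bijection from the vertices of $G$ to the set $\{x_1,\dots,x_n\}$. For each $j\in\{1,\dots,n-1\}$ let $P_j$ be a fixed shortest path from $x_j$ to $x_{j+1}$ (assumed to exist), and for each edge $e_i$ let $n(e_i)$ be the number of paths $P_j$ that contain $e_i$. Let $\{e_{i_1},\dots,e_{i_r}\}$ be a set of edges whose simultaneous removal gives a disconnected graph with two components having $V_1$ and $V_2$ vertices respectively. Assume that (a) whenever $x_j$ and $x_{j+1}$ lie in the same component, $P_j$ also lies in that component, and (b) each path $P_j$ contains at most one of the edges $e_{i_1},\dots,e_{i_r}$. Then $n(e_{i_1})+\dots+n(e_{i_r})\le 2\min\{V_1,V_2\}$. -}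

module Defs where

open import Data.Nat using (ℕ; zero; suc; _+_; _≤_)
open import Data.Fin using (Fin; inject₁) renaming (suc to fsuc)
open import Data.Fin.Properties using () renaming (_≟_ to _≟ᶠ_)
open import Data.Bool using (Bool; true; false; T)
open import Data.Product using (_×_; _,_; ∃)
open import Data.Sum using (_⊎_)
open import Data.List using (List; []; _∷_; length; filter; map; allFin)
open import Data.Nat.ListAction using (sum)
open import Data.List.Relation.Unary.All using (All)
open import Data.List.Relation.Unary.Any using (Any)
open import Data.List.Relation.Unary.Any using () renaming (any? to anyL?)
open import Data.List.Relation.Unary.Unique.Propositional using (Unique)
open import Relation.Binary.PropositionalEquality using (_≡_)
open import Relation.Nullary.Decidable using (Dec; does)
open import Function.Bundles using (_⇔_)

-- A (multi)graph on vertex set Fin n with edges indexed by Fin m;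
-- edge e joins the two vertices in  ends e  (loops/multi-edges allowed).
record Graph (n m : ℕ) : Set where
  field
    ends : Fin m → Fin n × Fin n
open Graph public

Joins : ∀ {n m} → Graph n m → Fin m → Fin n → Fin n → Set
Joins G e u w = (ends G e ≡ (u , w)) ⊎ (ends G e ≡ (w , u))

data Walk {n m} (G : Graph n m) : Fin n → Fin n → Set where
  [] : ∀ {u} → Walk G u u
  step : ∀ {u w v} (e : Fin m) → Joins G e u w → Walk G w v → Walk G u v

len : ∀ {n m} {G : Graph n m} {u v} → Walk G u v → ℕ
len [] = 0
len (step _ _ w) = suc (len w)

edgesOf : ∀ {n m} {G : Graph n m} {u v} → Walk G u v → List (Fin m)
edgesOf [] = []
edgesOf (step e _ w) = e ∷ edgesOf w

verticesOf : ∀ {n m} {G : Graph n m} {u v} → Walk G u v → List (Fin n)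
verticesOf {u = u} [] = u ∷ []
verticesOf {u = u} (step _ _ w) = u ∷ verticesOf w

IsPath : ∀ {n m} {G : Graph n m} {u v} → Walk G u v → Set
IsPath w = Unique (verticesOf w)

IsShortestPath : ∀ {n m} {G : Graph n m} {u v} → Walk G u v → Set
IsShortestPath {G = G} {u} {v} w = IsPath w × (∀ (w' : Walk G u v) → len w ≤ len w')

_∈E_ : ∀ {n m} {G : Graph n m} {u v} → Fin m → Walk G u v → Set
e ∈E w = Any (e ≡_) (edgesOf w)

_∈E?_ : ∀ {n m} {G : Graph n m} {u v} (e : Fin m) (w : Walk G u v) → Dec (e ∈E w)
e ∈E? w = anyL? (e ≟ᶠ_) (edgesOf w)

pathCount : ∀ {n m k} {G : Graph n m} {s t : Fin k → Fin n}
            (P : (j : Fin k) → Walk G (s j) (t j)) → Fin m → ℕ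
pathCount {k = k} P e = length (filter (λ j → e ∈E? P j) (allFin k))

-- u and v are connected in G with the edges in R removed (R e ≡ true means removed)
ConnectedWithout : ∀ {n m} → Graph n m → (Fin m → Bool) → Fin n → Fin n → Set
ConnectedWithout G R u v = ∃ λ (w : Walk G u v) → All (λ e → R e ≡ false) (edgesOf w)

sideSize : ∀ {n} → (Fin n → Bool) → Bool → ℕ
sideSize {n} side b = length (filter (λ v → side v Data.Bool.≟ b) (allFin n))

removedCount : ∀ {n m} {G : Graph n m} {u v} → (Fin m → Bool) → Walk G u v → ℕ
removedCount R w = length (filter (λ e → R e Data.Bool.≟ true) (edgesOf w))

sumOver : ∀ {m} → (Fin m → Bool) → (Fin m → ℕ) → ℕ
sumOver {m} R f = sum (map f (filter (λ e → R e Data.Bool.≟ true) (allFin m)))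

-- Double-count the pairs (e, j) with e a removed edge on P j.  By (a) a path whose
-- endpoints lie on the same side contains no removed edge, and by (b) any other path
-- contains at most one, so the sum is at most the number of indices j at which the
-- side of x j changes.  In a two-coloured sequence every change has an end of each
-- colour and every position is an end of at most two changes, so there are at most
-- twice as many changes as positions of either colour; as x is a bijection these
-- counts are V₁ and V₂.
module Submission where

open import Defs
open import Data.Nat using (ℕ; zero; suc; _≤_; _*_; _⊓_; _+_; z≤n; s≤s)
open import Data.Nat.Properties hiding (_≟_)
open import Data.Nat.ListAction using (sum)
open import Data.Nat.Tactic.RingSolver using (solve-∀)
open import Data.Fin using (Fin; inject₁) renaming (zero to fzero; suc to fsuc)
open import Data.Fin.Properties using () renaming (_≟_ to _≟ᶠ_)
open import Data.Fin.Permutation using (permutation)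
open import Data.Bool using (Bool; true; false; if_then_else_; _≟_)
open import Data.Bool.Properties using (not-¬)
open import Data.Product using (_×_; ∃; _,_; proj₁; proj₂)
open import Data.List using (List; []; _∷_; length; filter; map; tabulate; allFin)
open import Data.List.Properties using (map-tabulate; filter-none)
import Data.List.Relation.Unary.All as All
open import Data.List.Relation.Unary.All using (All)
open import Data.List.Relation.Unary.Any using (any?)
open import Algebra.Properties.Semiring.Sum +-*-semiring
  using (sum-syntax; ∑-comm; ∑-distrib-+; sum-permute; sum-replicate-zero; sum-cong-≗; *-distribˡ-sum)
  renaming (sum to ∑)
open import Relation.Binary.PropositionalEquality using (_≡_; refl; sym; trans; cong; cong₂; module ≡-Reasoning)
open import Relation.Nullary using (Dec; yes; no; does; ¬?)
open import Relation.Unary using (Pred; Decidable)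
open import Function.Base using (_∘_)
open import Function.Definitions using (Bijective)
open import Function.Bundles using (_⇔_)

𝟙 : ∀ {p} {P : Set p} → Dec P → ℕ
𝟙 d = if does d then 1 else 0

∑-mono-≤ : ∀ {n} {f g : Fin n → ℕ} → (∀ i → f i ≤ g i) → ∑[ i < n ] f i ≤ ∑[ i < n ] g i
∑-mono-≤ {zero}  f≤g = z≤n
∑-mono-≤ {suc n} f≤g = +-mono-≤ (f≤g fzero) (∑-mono-≤ (f≤g ∘ fsuc))

∑-*-𝟙≟ : ∀ {n} (f : Fin n → ℕ) (a : Fin n) → ∑[ i < n ] (f i * 𝟙 (i ≟ᶠ a)) ≡ f a
∑-*-𝟙≟ {suc n} f fzero = begin
    f fzero * 1 + ∑[ i < n ] (f (fsuc i) * 0)  ≡⟨ cong₂ _+_ (*-identityʳ (f fzero)) ∑-zero ⟩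
    f fzero + 0                                ≡⟨ +-identityʳ (f fzero) ⟩
    f fzero                                    ∎
  where
  open ≡-Reasoning
  ∑-zero : ∑[ i < n ] (f (fsuc i) * 0) ≡ 0
  ∑-zero = trans (sum-cong-≗ (λ i → *-zeroʳ (f (fsuc i)))) (sum-replicate-zero n)
∑-*-𝟙≟ {suc n} f (fsuc a) =
  trans (cong (_+ ∑[ i < n ] (f (fsuc i) * 𝟙 (i ≟ᶠ a))) (*-zeroʳ (f fzero))) (∑-*-𝟙≟ (f ∘ fsuc) a)

∑-∘-bijective : ∀ {n} {π : Fin n → Fin n} → Bijective _≡_ _≡_ π →
                (f : Fin n → ℕ) → ∑[ i < n ] f (π i) ≡ ∑[ i < n ] f i
∑-∘-bijective {n} {π} (π-injective , π-surjective) f =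
  sym (sum-permute f (permutation π π⁻¹ π∘π⁻¹ π⁻¹∘π))
  where
  π⁻¹ : Fin n → Fin n
  π⁻¹ y = proj₁ (π-surjective y)
  π∘π⁻¹ : ∀ y → π (π⁻¹ y) ≡ y
  π∘π⁻¹ y = proj₂ (π-surjective y) refl
  π⁻¹∘π : ∀ i → π⁻¹ (π i) ≡ i
  π⁻¹∘π i = π-injective (π∘π⁻¹ (π i))

sum-tabulate : ∀ {n} (f : Fin n → ℕ) → sum (tabulate f) ≡ ∑[ i < n ] f i
sum-tabulate {zero}  f = refl
sum-tabulate {suc n} f = cong (f fzero +_) (sum-tabulate (f ∘ fsuc))

sum-map-allFin : ∀ {n} (f : Fin n → ℕ) → sum (map f (allFin n)) ≡ ∑[ i < n ] f i
sum-map-allFin f = trans (cong sum (map-tabulate (λ i → i) f)) (sum-tabulate f)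

module _ {a p} {A : Set a} {P : Pred A p} (P? : Decidable P) where

  sum-map-filter : (f : A → ℕ) (xs : List A) →
                   sum (map f (filter P? xs)) ≡ sum (map (λ x → 𝟙 (P? x) * f x) xs)
  sum-map-filter f []       = refl
  sum-map-filter f (x ∷ xs) with P? x
  ... | yes _ = cong₂ _+_ (sym (+-identityʳ (f x))) (sum-map-filter f xs)
  ... | no _  = sum-map-filter f xs

  length-filter≡sum-𝟙 : (xs : List A) → length (filter P? xs) ≡ sum (map (𝟙 ∘ P?) xs)
  length-filter≡sum-𝟙 []       = refl
  length-filter≡sum-𝟙 (x ∷ xs) with P? x
  ... | yes _ = cong suc (length-filter≡sum-𝟙 xs)
  ... | no _  = length-filter≡sum-𝟙 xs

  𝟙-any-∷ : ∀ x xs → 𝟙 (any? P? (x ∷ xs)) ≤ 𝟙 (P? x) + 𝟙 (any? P? xs)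
  𝟙-any-∷ x xs with P? x | any? P? xs
  ... | yes _ | _     = s≤s z≤n
  ... | no _  | yes _ = ≤-refl
  ... | no _  | no _  = z≤n

length-filter-allFin : ∀ {n p} {P : Pred (Fin n) p} (P? : Decidable P) →
                       length (filter P? (allFin n)) ≡ ∑[ i < n ] 𝟙 (P? i)
length-filter-allFin {n} P? = trans (length-filter≡sum-𝟙 P? (allFin n)) (sum-map-allFin (𝟙 ∘ P?))

-- The left-hand side counts the distinct elements of xs satisfying P.
∑-𝟙-∈≤length-filter : ∀ {m p} {P : Pred (Fin m) p} (P? : Decidable P) (xs : List (Fin m)) →
                      ∑[ e < m ] (𝟙 (P? e) * 𝟙 (any? (e ≟ᶠ_) xs)) ≤ length (filter P? xs)
∑-𝟙-∈≤length-filter {m} P? [] =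
  ≤-reflexive (trans (sum-cong-≗ (λ e → *-zeroʳ (𝟙 (P? e)))) (sum-replicate-zero m))
∑-𝟙-∈≤length-filter {m} P? (a ∷ xs) = begin
    ∑[ e < m ] (𝟙 (P? e) * 𝟙 (any? (e ≟ᶠ_) (a ∷ xs)))
  ≤⟨ ∑-mono-≤ (λ e → *-monoʳ-≤ (𝟙 (P? e)) (𝟙-any-∷ (e ≟ᶠ_) a xs)) ⟩
    ∑[ e < m ] (𝟙 (P? e) * (𝟙 (e ≟ᶠ a) + 𝟙 (any? (e ≟ᶠ_) xs)))
  ≡⟨ sum-cong-≗ (λ e → *-distribˡ-+ (𝟙 (P? e)) _ _) ⟩
    ∑[ e < m ] (𝟙 (P? e) * 𝟙 (e ≟ᶠ a) + 𝟙 (P? e) * 𝟙 (any? (e ≟ᶠ_) xs))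
  ≡⟨ ∑-distrib-+ (λ e → 𝟙 (P? e) * 𝟙 (e ≟ᶠ a)) (λ e → 𝟙 (P? e) * 𝟙 (any? (e ≟ᶠ_) xs)) ⟩
    ∑[ e < m ] (𝟙 (P? e) * 𝟙 (e ≟ᶠ a)) + ∑[ e < m ] (𝟙 (P? e) * 𝟙 (any? (e ≟ᶠ_) xs))
  ≤⟨ +-mono-≤ (≤-reflexive (∑-*-𝟙≟ (𝟙 ∘ P?) a)) (∑-𝟙-∈≤length-filter P? xs) ⟩
    𝟙 (P? a) + length (filter P? xs)
  ≡⟨ cong (𝟙 (P? a) +_) (length-filter≡sum-𝟙 P? xs) ⟩
    sum (map (𝟙 ∘ P?) (a ∷ xs))
  ≡⟨ length-filter≡sum-𝟙 P? (a ∷ xs) ⟨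
    length (filter P? (a ∷ xs))
  ∎
  where open ≤-Reasoning

sumOver-pathCount : ∀ {n m k} {G : Graph n m} {s t : Fin k → Fin n}
                    (R : Fin m → Bool) (P : (j : Fin k) → Walk G (s j) (t j)) →
                    sumOver R (pathCount P) ≡ ∑[ j < k ] ∑[ e < m ] (𝟙 (R e ≟ true) * 𝟙 (e ∈E? P j))
sumOver-pathCount {m = m} {k} R P = begin
    sumOver R (pathCount P)
  ≡⟨ sum-map-filter R? (pathCount P) (allFin m) ⟩
    sum (map (λ e → 𝟙 (R? e) * pathCount P e) (allFin m))
  ≡⟨ sum-map-allFin (λ e → 𝟙 (R? e) * pathCount P e) ⟩
    ∑[ e < m ] (𝟙 (R? e) * pathCount P e)
  ≡⟨ sum-cong-≗ (λ e → cong (𝟙 (R? e) *_) (length-filter-allFin (λ j → e ∈E? P j))) ⟩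
    ∑[ e < m ] (𝟙 (R? e) * ∑[ j < k ] 𝟙 (e ∈E? P j))
  ≡⟨ sum-cong-≗ (λ e → *-distribˡ-sum (𝟙 (R? e)) (λ j → 𝟙 (e ∈E? P j))) ⟩
    ∑[ e < m ] ∑[ j < k ] (𝟙 (R? e) * 𝟙 (e ∈E? P j))
  ≡⟨ ∑-comm (λ e j → 𝟙 (R? e) * 𝟙 (e ∈E? P j)) ⟩
    ∑[ j < k ] ∑[ e < m ] (𝟙 (R? e) * 𝟙 (e ∈E? P j))
  ∎
  where
  open ≡-Reasoning
  R? : Decidable (λ e → R e ≡ true)
  R? e = R e ≟ true

removedCount-avoiding : ∀ {n m} {G : Graph n m} {u v} (R : Fin m → Bool) (w : Walk G u v) →
                        All (λ e → R e ≡ false) (edgesOf w) → removedCount R w ≡ 0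
removedCount-avoiding R w avoids =
  cong length (filter-none (λ e → R e ≟ true) (All.map not-¬ avoids))

changes : ∀ {k} → (Fin (suc k) → Bool) → ℕ
changes {k} c = ∑[ j < k ] 𝟙 (¬? (c (inject₁ j) ≟ c (fsuc j)))

occurrences : ∀ {n} → (Fin n → Bool) → Bool → ℕ
occurrences {n} c b = ∑[ i < n ] 𝟙 (c i ≟ b)

𝟙≢≤𝟙≡+𝟙≡ : ∀ x y b → 𝟙 (¬? (x ≟ y)) ≤ 𝟙 (x ≟ b) + 𝟙 (y ≟ b)
𝟙≢≤𝟙≡+𝟙≡ false false _     = z≤n
𝟙≢≤𝟙≡+𝟙≡ true  true  _     = z≤n
𝟙≢≤𝟙≡+𝟙≡ false true  false = ≤-refl
𝟙≢≤𝟙≡+𝟙≡ false true  true  = ≤-refl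
𝟙≢≤𝟙≡+𝟙≡ true  false false = ≤-refl
𝟙≢≤𝟙≡+𝟙≡ true  false true  = ≤-refl

changes+𝟙-head≤2*occurrences : ∀ {k} (c : Fin (suc k) → Bool) (b : Bool) →
                               changes c + 𝟙 (c fzero ≟ b) ≤ 2 * occurrences c b
changes+𝟙-head≤2*occurrences {zero} c b = ≤-trans (m≤m+n x₀ 0) (m≤n*m (x₀ + 0) 2)
  where x₀ = 𝟙 (c fzero ≟ b)
changes+𝟙-head≤2*occurrences {suc k} c b = begin
    𝟙 (¬? (c fzero ≟ c′ fzero)) + changes c′ + x₀
  ≤⟨ +-monoˡ-≤ x₀ (+-monoˡ-≤ (changes c′) (𝟙≢≤𝟙≡+𝟙≡ (c fzero) (c′ fzero) b)) ⟩
    x₀ + x₁ + changes c′ + x₀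
  ≡⟨ regroup x₀ x₁ (changes c′) ⟩
    2 * x₀ + (changes c′ + x₁)
  ≤⟨ +-monoʳ-≤ (2 * x₀) (changes+𝟙-head≤2*occurrences c′ b) ⟩
    2 * x₀ + 2 * occurrences c′ b
  ≡⟨ *-distribˡ-+ 2 x₀ (occurrences c′ b) ⟨
    2 * (x₀ + occurrences c′ b)
  ∎
  where
  open ≤-Reasoning
  c′ = c ∘ fsuc
  x₀ = 𝟙 (c fzero ≟ b)
  x₁ = 𝟙 (c′ fzero ≟ b)
  regroup : ∀ x y z → x + y + z + x ≡ 2 * x + (z + y)
  regroup = solve-∀

changes≤2*occurrences : ∀ {k} (c : Fin (suc k) → Bool) (b : Bool) → changes c ≤ 2 * occurrences c b
changes≤2*occurrences c b = ≤-trans (m≤m+n (changes c) _) (changes+𝟙-head≤2*occurrences c b)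

-- Neither shortest-ness, nor the connectivity description of the cut, nor non-emptiness
-- of the sides, nor the vertex half of (a) is needed.
mainTheorem7 : ∀ {k m} (G : Graph (ℕ.suc k) m)
    → (x : Fin (ℕ.suc k) → Fin (ℕ.suc k)) → Bijective _≡_ _≡_ x
    → (P : (j : Fin k) → Walk G (x (inject₁ j)) (x (fsuc j)))
    → (∀ j → IsShortestPath (P j))
    → (R : Fin m → Bool)
    → (side : Fin (ℕ.suc k) → Bool)
    → (∀ u v → ConnectedWithout G R u v ⇔ (side u ≡ side v))
    → (∃ λ u → side u ≡ false) → (∃ λ u → side u ≡ true)
    → (∀ j → side (x (inject₁ j)) ≡ side (x (fsuc j))
         → All (λ v → side v ≡ side (x (inject₁ j))) (verticesOf (P j))
           × All (λ e → R e ≡ false) (edgesOf (P j)))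
    → (∀ j → removedCount R (P j) ≤ 1)
    → sumOver R (pathCount P) ≤ 2 * (sideSize side false ⊓ sideSize side true)
mainTheorem7 {k} {m} _ x x-bijective P _ R side _ _ _ sameSide⇒inside crossesOnce =
  ≤-trans (⊓-glb (bound false) (bound true))
          (≤-reflexive (sym (*-distribˡ-⊓ 2 (sideSize side false) (sideSize side true))))
  where
  removedCount≤change : ∀ j → removedCount R (P j) ≤ 𝟙 (¬? (side (x (inject₁ j)) ≟ side (x (fsuc j))))
  removedCount≤change j with side (x (inject₁ j)) ≟ side (x (fsuc j))
  ... | yes same = ≤-reflexive (removedCount-avoiding R (P j) (proj₂ (sameSide⇒inside j same)))
  ... | no _     = crossesOnce j

  bound : ∀ b → sumOver R (pathCount P) ≤ 2 * sideSize side b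
  bound b = begin
      sumOver R (pathCount P)
    ≡⟨ sumOver-pathCount R P ⟩
      ∑[ j < k ] ∑[ e < m ] (𝟙 (R e ≟ true) * 𝟙 (e ∈E? P j))
    ≤⟨ ∑-mono-≤ (λ j → ∑-𝟙-∈≤length-filter (λ e → R e ≟ true) (edgesOf (P j))) ⟩
      ∑[ j < k ] removedCount R (P j)
    ≤⟨ ∑-mono-≤ removedCount≤change ⟩
      changes (side ∘ x)
    ≤⟨ changes≤2*occurrences (side ∘ x) b ⟩
      2 * occurrences (side ∘ x) b
    ≡⟨ cong (2 *_) (∑-∘-bijective x-bijective (λ v → 𝟙 (side v ≟ b))) ⟩
      2 * occurrences side b
    ≡⟨ cong (2 *_) (length-filter-allFin (λ v → side v ≟ b)) ⟨
      2 * sideSize side b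
    ∎
    where open ≤-Reasoning
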